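{- Let $G \in ER(n,d,\lambda)$ and let $x \ge 1$ be an integer. Then $D_n^x(G,G)$ is edge-regular if and only if there exist integers $\bar d, \bar\lambda$ such that: (1) for all $v \in V(G)$, $d(1 + |N^x(v)|) = \bar d$; (2) for all $u,v \in V(G)$ with $u \sim v$ in $G$, $\lambda + d|N^x(u) \cap N^x(v)| = \bar\lambda$; (3) for all $v,w \in V(G)$ with $w \in N^x(v)$, $|N^x(v) \cap N(w)| + |N(v) \cap N^x(w)| + \lambda|N^x(v) \cap N^x(w)| = \bar\lambda$.
   Context: All graphs are finite and simple. For a vertex $v$ of $G$, $N(v)$ is its neighborhood and, for a positive integer $x$, $N^x(v)$ is the set of vertices at distance exactly $x$ from $v$ in $G$. A graph is edge-regular if it is regular and there is $\lambda \ge 0$ such that every two adjacent vertices have exactly $\lambda$ common neighbors; $ER(n,d,\lambda)$ denotes the set of edge-regular graphs on $n$ vertices, regular of degree $d$, with parameter $\lambda$. For finite graphs $G, H$ with $m = |V(H)|$, vertices of $H$ ordered $w_1,\dots,w_m$, and $x \ge 1$, the $(H,x)$-shadow $D_m^x(G,H)$ is the simple graph whose vertex set is the disjoint union of $m$ copies $G_1,\dots,G_m$ of $G$ (the copy of $u\in V(G)$ in $G_i$ denoted $u_i$), with edges $u_iv_i$ for $uv \in E(G)$, and edges $u_iv_j$ for $i \ne j$ whenever $w_iw_j \in E(H)$ and $u \in N_G^x(v)$. Here $H = G$, so $m = n$. -}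

module Defs where

open import Data.Nat using (ℕ; zero; suc; _+_; _*_)
open import Data.Bool using (Bool; true; false; _∧_; _∨_; not; T)
open import Data.Fin using (Fin; remQuot)
open import Data.Fin.Properties using (_≟_)
open import Data.List using (List; length; filter)
open import Data.Bool.ListAction using (any)
open import Data.List using () renaming (allFin to allFinL)
open import Data.Product using (_×_; _,_; Σ; ∃₂)
open import Relation.Binary.PropositionalEquality using (_≡_)
open import Relation.Nullary using (¬_)
open import Relation.Nullary.Decidable using (⌊_⌋)
open import Data.Bool using (T?)

Adj : ℕ → Set
Adj n = Fin n → Fin n → Bool

IsSimple : ∀ {n} → Adj n → Set
IsSimple {n} A = (∀ u v → A u v ≡ A v u) × (∀ u → A u u ≡ false)

count : ∀ {n} → (Fin n → Bool) → ℕ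
count {n} p = length (filter (λ v → T? (p v)) (allFinL n))

within : ∀ {n} → Adj n → ℕ → Fin n → Fin n → Bool
within {n} A zero    u v = ⌊ u ≟ v ⌋
within {n} A (suc k) u v =
  within A k u v ∨ any (λ w → within A k u w ∧ A w v) (allFinL n)

-- distExactly A x u v : dist(u,v) = x exactly (for x ≥ 1), i.e. v ∈ N^x(u)
distExactly : ∀ {n} → Adj n → ℕ → Fin n → Fin n → Bool
distExactly A zero    u v = within A zero u v
distExactly A (suc k) u v = within A (suc k) u v ∧ not (within A k u v)

deg : ∀ {n} → Adj n → Fin n → ℕ
deg A v = count (A v)

common : ∀ {n} → Adj n → Fin n → Fin n → ℕ
common A u v = count (λ w → A u w ∧ A v w)

IsER : ∀ {n} → Adj n → ℕ → ℕ → Set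
IsER {n} A d l =
  (∀ v → deg A v ≡ d) × (∀ u v → T (A u v) → common A u v ≡ l)

EdgeRegular : ∀ {n} → Adj n → Set
EdgeRegular A = ∃₂ λ d l → IsER A d l

-- Its vertex set is
-- Fin (n * n); a vertex p corresponds (via remQuot) to (i , u),
-- meaning the copy u_i of vertex u in the i-th copy G_i, where H = G
-- and w_i is vertex i of G.
shadow : ∀ {n} → Adj n → ℕ → Adj (n * n)
shadow {n} A x p q with remQuot {n} n p | remQuot {n} n q
... | (i , u) | (j , v) =
  (⌊ i ≟ j ⌋ ∧ A u v) ∨ (not ⌊ i ≟ j ⌋ ∧ A i j ∧ distExactly A x u v)

{-# OPTIONS --safe #-}
-- Write the vertex u_i of the shadow as (i , u). Its neighbourhood indicator, a vector indexed
-- by Fin n × Fin n, is δ i ⊗ χ N(u) + χ N(i) ⊗ χ N^x(u): the neighbours inside copy i plus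
-- the x-distant vertices in the adjacent copies (the two never overlap, as G has no loops).
-- Degrees and common-neighbour counts are sums and dot products of such indicators, so
-- bilinearity and (f ⊗ g) · (h ⊗ k) = (f · h) (g · k) give
--   deg (i , u) = deg u + deg i |N^x(u)|,
--   |N(i , u) ∩ N(j , v)| = [i = j] |N(u) ∩ N(v)| + [i ~ j] |N^x(u) ∩ N(v)|
--                          + [j ~ i] |N(u) ∩ N^x(v)| + |N(i) ∩ N(j)| |N^x(u) ∩ N^x(v)|.
-- An edge of the shadow is a copy of an edge of G, where the second formula becomes
-- condition (2), or joins x-distant vertices of adjacent copies, where it becomes (3).
-- Conversely every such pair is realised, the second kind because x ≥ 1 forces G to
-- have an edge.
module Submission where

open import Defs
open import Data.Bool using (Bool; true; false; T; T?; _∧_; _∨_; not)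
open import Data.Bool.Properties using (T-∧; T-≡; ∨-identityʳ; ∧-idem)
open import Data.Fin using (Fin; zero; suc; combine; remQuot; _↑ˡ_; _↑ʳ_)
open import Data.Fin.Properties using (_≟_; remQuot-combine; combine-surjective)
open import Data.List using (length; filter; tabulate; allFin)
open import Data.List.Relation.Unary.Any using (satisfied)
open import Data.List.Relation.Unary.Any.Properties using (any⁻)
open import Data.Nat using (ℕ; zero; suc; _+_; _*_; _≥_)
open import Data.Nat.Properties
  using (+-*-semiring; *-commutativeSemigroup; +-assoc; +-identityʳ; *-identityˡ; *-identityʳ; *-comm; *-suc;
         *-distribˡ-+; *-distribʳ-+)
open import Data.Product using (∃₂; _×_; _,_; proj₁; proj₂; uncurry)
open import Data.Sum using (_⊎_; inj₁; inj₂; [_,_])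
open import Data.Vec.Functional using (Vector; tail)
open import Data.Empty using (⊥-elim)
open import Function.Base using (_∘_)
open import Function.Bundles using (_⇔_; mk⇔; Equivalence)
open import Relation.Binary.PropositionalEquality
  using (_≡_; _≢_; _≗_; refl; sym; trans; cong; cong₂; subst; module ≡-Reasoning)
open import Relation.Nullary using (yes; no)
open import Relation.Nullary.Decidable using (⌊_⌋)

open import Algebra.Properties.CommutativeSemigroup *-commutativeSemigroup
  using () renaming (interchange to *-interchange)
open import Algebra.Properties.Semiring.Sum +-*-semiring
  using (sum; sum-syntax; sum-cong-≗; sum-replicate-zero; ∑-distrib-+; *-distribˡ-sum; *-distribʳ-sum)

open Equivalence using (to; from)

⟦_⟧ : Bool → ℕ
⟦ true ⟧  = 1
⟦ false ⟧ = 0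

⟦∧⟧ : ∀ a b → ⟦ a ∧ b ⟧ ≡ ⟦ a ⟧ * ⟦ b ⟧
⟦∧⟧ true  b = sym (+-identityʳ ⟦ b ⟧)
⟦∧⟧ false b = refl

∑-↑ : ∀ m {n} (f : Vector ℕ (m + n)) → sum f ≡ ∑[ i < m ] f (i ↑ˡ n) + ∑[ j < n ] f (m ↑ʳ j)
∑-↑ zero    f = refl
∑-↑ (suc m) f = trans (cong (f zero +_) (∑-↑ m (tail f))) (sym (+-assoc (f zero) _ _))

∑-combine : ∀ m {n} (f : Vector ℕ (m * n)) → sum f ≡ ∑[ i < m ] ∑[ j < n ] f (combine i j)
∑-combine zero    f = refl
∑-combine (suc m) {n} f =
  trans (∑-↑ n f) (cong (∑[ j < n ] f (j ↑ˡ m * n) +_) (∑-combine m (f ∘ (n ↑ʳ_))))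

_⊕_ : ∀ {n} → Vector ℕ n → Vector ℕ n → Vector ℕ n
(f ⊕ g) i = f i + g i

_⊗_ : ∀ {m n} → Vector ℕ m → Vector ℕ n → Vector ℕ (m * n)
_⊗_ {m} {n} f g p = uncurry (λ i j → f i * g j) (remQuot {m} n p)

⊗-combine : ∀ {m n} (f : Vector ℕ m) (g : Vector ℕ n) i j → (f ⊗ g) (combine i j) ≡ f i * g j
⊗-combine f g i j = cong (uncurry (λ i j → f i * g j)) (remQuot-combine i j)

∑-⊗ : ∀ {m n} (f : Vector ℕ m) (g : Vector ℕ n) → sum (f ⊗ g) ≡ sum f * sum g
∑-⊗ {m} {n} f g = begin
  sum (f ⊗ g)                                  ≡⟨ ∑-combine m (f ⊗ g) ⟩
  ∑[ i < m ] ∑[ j < n ] (f ⊗ g) (combine i j)  ≡⟨ sum-cong-≗ (λ i → sum-cong-≗ (⊗-combine f g i)) ⟩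
  ∑[ i < m ] ∑[ j < n ] (f i * g j)            ≡⟨ sum-cong-≗ (λ i → *-distribˡ-sum (f i) g) ⟨
  ∑[ i < m ] (f i * sum g)                     ≡⟨ *-distribʳ-sum (sum g) f ⟨
  sum f * sum g                                ∎
  where open ≡-Reasoning

infix 7 _·_
infixl 6 _⊕_
infixl 7 _⊗_

_·_ : ∀ {n} → Vector ℕ n → Vector ℕ n → ℕ
f · g = ∑[ i < _ ] (f i * g i)

·-cong : ∀ {n} {f f′ g g′ : Vector ℕ n} → f ≗ f′ → g ≗ g′ → f · g ≡ f′ · g′
·-cong f≗f′ g≗g′ = sum-cong-≗ (λ i → cong₂ _*_ (f≗f′ i) (g≗g′ i))

·-comm : ∀ {n} (f g : Vector ℕ n) → f · g ≡ g · f
·-comm f g = sum-cong-≗ (λ i → *-comm (f i) (g i))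

·-distribˡ-⊕ : ∀ {n} (f g h : Vector ℕ n) → f · (g ⊕ h) ≡ f · g + f · h
·-distribˡ-⊕ f g h =
  trans (sum-cong-≗ (λ i → *-distribˡ-+ (f i) (g i) (h i))) (∑-distrib-+ (λ i → f i * g i) _)

·-distribʳ-⊕ : ∀ {n} (f g h : Vector ℕ n) → (g ⊕ h) · f ≡ g · f + h · f
·-distribʳ-⊕ f g h =
  trans (sum-cong-≗ (λ i → *-distribʳ-+ (f i) (g i) (h i))) (∑-distrib-+ (λ i → g i * f i) _)

·-bilinear : ∀ {n} (f g h k : Vector ℕ n) → (f ⊕ g) · (h ⊕ k) ≡ f · h + g · h + f · k + g · k
·-bilinear f g h k = begin
  (f ⊕ g) · (h ⊕ k)                   ≡⟨ ·-distribˡ-⊕ (f ⊕ g) h k ⟩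
  (f ⊕ g) · h + (f ⊕ g) · k           ≡⟨ cong₂ _+_ (·-distribʳ-⊕ h f g) (·-distribʳ-⊕ k f g) ⟩
  f · h + g · h + (f · k + g · k)     ≡⟨ sym (+-assoc (f · h + g · h) _ _) ⟩
  f · h + g · h + f · k + g · k       ∎
  where open ≡-Reasoning

⊗-·-⊗ : ∀ {m n} (f h : Vector ℕ m) (g k : Vector ℕ n) → (f ⊗ g) · (h ⊗ k) ≡ (f · h) * (g · k)
⊗-·-⊗ {m} {n} f h g k = begin
  (f ⊗ g) · (h ⊗ k)                              ≡⟨ sum-cong-≗ pointwise ⟩
  sum ((λ i → f i * h i) ⊗ (λ j → g j * k j))    ≡⟨ ∑-⊗ (λ i → f i * h i) (λ j → g j * k j) ⟩
  (f · h) * (g · k)                              ∎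
  where
  open ≡-Reasoning
  pointwise : ∀ p → (f ⊗ g) p * (h ⊗ k) p ≡ ((λ i → f i * h i) ⊗ (λ j → g j * k j)) p
  pointwise p = let (i , j) = remQuot {m} n p in *-interchange (f i) (g j) (h i) (k j)

δ : ∀ {n} → Fin n → Vector ℕ n
δ i k = ⟦ ⌊ i ≟ k ⌋ ⟧

δ-suc : ∀ {n} (i k : Fin n) → δ (suc i) (suc k) ≡ δ i k
δ-suc i k with i ≟ k
... | yes _ = refl
... | no  _ = refl

δ-diag : ∀ {n} (i : Fin n) → δ i i ≡ 1
δ-diag i with i ≟ i
... | yes _   = refl
... | no i≢i = ⊥-elim (i≢i refl)

δ-off : ∀ {n} {i j : Fin n} → i ≢ j → δ i j ≡ 0
δ-off {i = i} {j} i≢j with i ≟ j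
... | yes i≡j = ⊥-elim (i≢j i≡j)
... | no _    = refl

δ-· : ∀ {n} (i : Fin n) (f : Vector ℕ n) → δ i · f ≡ f i
δ-· {suc n} zero    f =
  trans (cong (1 * f zero +_) (sum-replicate-zero n)) (trans (+-identityʳ _) (*-identityˡ (f zero)))
δ-· {suc n} (suc i) f = trans (sum-cong-≗ (λ k → cong (_* f (suc k)) (δ-suc i k))) (δ-· i (tail f))

·-δ : ∀ {n} (f : Vector ℕ n) (i : Fin n) → f · δ i ≡ f i
·-δ f i = trans (·-comm f (δ i)) (δ-· i f)

∑-δ : ∀ {n} (i : Fin n) → sum (δ i) ≡ 1
∑-δ i = trans (sum-cong-≗ (λ k → sym (*-identityʳ (δ i k)))) (δ-· i (λ _ → 1))

χ : ∀ {n} → (Fin n → Bool) → Vector ℕ n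
χ p i = ⟦ p i ⟧

length-filter-tabulate : ∀ {A : Set} {n} (p : A → Bool) (f : Fin n → A) →
  length (filter (T? ∘ p) (tabulate f)) ≡ ∑[ i < n ] ⟦ p (f i) ⟧
length-filter-tabulate {n = zero}  p f = refl
length-filter-tabulate {n = suc n} p f with p (f zero)
... | true  = cong suc (length-filter-tabulate p (f ∘ suc))
... | false = length-filter-tabulate p (f ∘ suc)

count≡∑χ : ∀ {n} (p : Fin n → Bool) → count p ≡ sum (χ p)
count≡∑χ p = length-filter-tabulate p (λ i → i)

count-∧ : ∀ {n} (p q : Fin n → Bool) → count (λ i → p i ∧ q i) ≡ χ p · χ q
count-∧ p q = trans (count≡∑χ (λ i → p i ∧ q i)) (sum-cong-≗ (λ i → ⟦∧⟧ (p i) (q i)))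

common-self : ∀ {n} (A : Adj n) u → common A u u ≡ deg A u
common-self A u = begin
  count (λ w → A u w ∧ A u w)  ≡⟨ count≡∑χ (λ w → A u w ∧ A u w) ⟩
  sum (χ (λ w → A u w ∧ A u w)) ≡⟨ sum-cong-≗ (λ w → cong ⟦_⟧ (∧-idem (A u w))) ⟩
  sum (χ (A u))                 ≡⟨ count≡∑χ (A u) ⟨
  count (A u)                   ∎
  where open ≡-Reasoning

distExactly⇒edge : ∀ {n} (A : Adj n) {x} → x ≥ 1 → ∀ u v → T (distExactly A x u v) →
                   ∃₂ λ w z → T (A w z)
distExactly⇒edge {n} A {suc k} _ u v uv =
  let (w , uwv) = satisfied (any⁻ _ (allFin n) (lastStep (within A k u v) (to T-∧ uv)))
  in  w , v , proj₂ (to T-∧ uwv)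
  where
  lastStep : ∀ b {c} → T (b ∨ c) × T (not b) → T c
  lastStep false (c , _) = c

module Shadow {n} (A : Adj n) (irrefl : ∀ u → A u u ≡ false) (x : ℕ) where

  dist : Fin n → Fin n → Bool
  dist = distExactly A x

  edge⇒≢ : ∀ {i j} → T (A i j) → i ≢ j
  edge⇒≢ {i} ii refl = subst T (irrefl i) ii

  shadow-adjacency : Fin n × Fin n → Fin n × Fin n → Bool
  shadow-adjacency (i , u) (j , v) = (⌊ i ≟ j ⌋ ∧ A u v) ∨ (not ⌊ i ≟ j ⌋ ∧ A i j ∧ dist u v)

  shadow-combineˡ : ∀ i u q → shadow A x (combine i u) q ≡ shadow-adjacency (i , u) (remQuot n q)
  shadow-combineˡ i u q = cong (λ p → shadow-adjacency p (remQuot n q)) (remQuot-combine i u)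

  shadow-combine : ∀ i u j v → shadow A x (combine i u) (combine j v) ≡ shadow-adjacency (i , u) (j , v)
  shadow-combine i u j v =
    trans (shadow-combineˡ i u (combine j v)) (cong (shadow-adjacency (i , u)) (remQuot-combine j v))

  ⟦shadow-adjacency⟧ : ∀ i u k w →
    ⟦ shadow-adjacency (i , u) (k , w) ⟧ ≡ δ i k * ⟦ A u w ⟧ + ⟦ A i k ⟧ * ⟦ dist u w ⟧
  ⟦shadow-adjacency⟧ i u k w with i ≟ k
  ... | yes refl rewrite irrefl i =
    trans (cong ⟦_⟧ (∨-identityʳ (A u w)))
          (sym (trans (+-identityʳ (1 * ⟦ A u w ⟧)) (*-identityˡ ⟦ A u w ⟧)))
  ... | no _ = ⟦∧⟧ (A i k) (dist u w)

  sameCopy otherCopies : Fin n → Fin n → Vector ℕ (n * n)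
  sameCopy    i u = δ i ⊗ χ (A u)
  otherCopies i u = χ (A i) ⊗ χ (dist u)

  χ-shadow : ∀ i u → χ (shadow A x (combine i u)) ≗ sameCopy i u ⊕ otherCopies i u
  χ-shadow i u q =
    trans (cong ⟦_⟧ (shadow-combineˡ i u q)) (let (k , w) = remQuot {n} n q in ⟦shadow-adjacency⟧ i u k w)

  deg-shadow : ∀ i u → deg (shadow A x) (combine i u) ≡ deg A u + deg A i * count (dist u)
  deg-shadow i u = begin
    deg (shadow A x) (combine i u)
      ≡⟨ count≡∑χ (shadow A x (combine i u)) ⟩
    sum (χ (shadow A x (combine i u)))
      ≡⟨ sum-cong-≗ (χ-shadow i u) ⟩
    sum (sameCopy i u ⊕ otherCopies i u)
      ≡⟨ ∑-distrib-+ (sameCopy i u) (otherCopies i u) ⟩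
    sum (sameCopy i u) + sum (otherCopies i u)
      ≡⟨ cong₂ _+_ (∑-⊗ (δ i) (χ (A u))) (∑-⊗ (χ (A i)) (χ (dist u))) ⟩
    sum (δ i) * sum (χ (A u)) + sum (χ (A i)) * sum (χ (dist u))
      ≡⟨ cong₂ _+_ (cong₂ _*_ (∑-δ i) (sym (count≡∑χ (A u))))
                   (cong₂ _*_ (sym (count≡∑χ (A i))) (sym (count≡∑χ (dist u)))) ⟩
    1 * deg A u + deg A i * count (dist u)
      ≡⟨ cong (_+ deg A i * count (dist u)) (*-identityˡ (deg A u)) ⟩
    deg A u + deg A i * count (dist u)
      ∎
    where open ≡-Reasoning

  common-shadow : ∀ i u j v → common (shadow A x) (combine i u) (combine j v)
    ≡ δ i j * common A u v
      + ⟦ A i j ⟧ * count (λ w → dist u w ∧ A v w)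
      + ⟦ A j i ⟧ * count (λ w → A u w ∧ dist v w)
      + common A i j * count (λ w → dist u w ∧ dist v w)
  common-shadow i u j v = begin
    common (shadow A x) (combine i u) (combine j v)
      ≡⟨ count-∧ (shadow A x (combine i u)) (shadow A x (combine j v)) ⟩
    χ (shadow A x (combine i u)) · χ (shadow A x (combine j v))
      ≡⟨ ·-cong (χ-shadow i u) (χ-shadow j v) ⟩
    (sameCopy i u ⊕ otherCopies i u) · (sameCopy j v ⊕ otherCopies j v)
      ≡⟨ ·-bilinear (sameCopy i u) (otherCopies i u) (sameCopy j v) (otherCopies j v) ⟩
    sameCopy i u · sameCopy j v + otherCopies i u · sameCopy j v
      + sameCopy i u · otherCopies j v + otherCopies i u · otherCopies j v
      ≡⟨ cong₂ _+_ (cong₂ _+_ (cong₂ _+_ same·same other·same) same·other) other·other ⟩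
    δ i j * common A u v
      + ⟦ A i j ⟧ * count (λ w → dist u w ∧ A v w)
      + ⟦ A j i ⟧ * count (λ w → A u w ∧ dist v w)
      + common A i j * count (λ w → dist u w ∧ dist v w)  ∎
    where
    open ≡-Reasoning
    same·same : sameCopy i u · sameCopy j v ≡ δ i j * common A u v
    same·same = trans (⊗-·-⊗ (δ i) (δ j) (χ (A u)) (χ (A v)))
                      (cong₂ _*_ (·-δ (δ i) j) (sym (count-∧ (A u) (A v))))
    other·same : otherCopies i u · sameCopy j v ≡ ⟦ A i j ⟧ * count (λ w → dist u w ∧ A v w)
    other·same = trans (⊗-·-⊗ (χ (A i)) (δ j) (χ (dist u)) (χ (A v)))
                       (cong₂ _*_ (·-δ (χ (A i)) j) (sym (count-∧ (dist u) (A v))))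
    same·other : sameCopy i u · otherCopies j v ≡ ⟦ A j i ⟧ * count (λ w → A u w ∧ dist v w)
    same·other = trans (⊗-·-⊗ (δ i) (χ (A j)) (χ (A u)) (χ (dist v)))
                       (cong₂ _*_ (δ-· i (χ (A j))) (sym (count-∧ (A u) (dist v))))
    other·other : otherCopies i u · otherCopies j v ≡ common A i j * count (λ w → dist u w ∧ dist v w)
    other·other = trans (⊗-·-⊗ (χ (A i)) (χ (A j)) (χ (dist u)) (χ (dist v)))
                        (cong₂ _*_ (sym (count-∧ (A i) (A j))) (sym (count-∧ (dist u) (dist v))))

  ShadowEdge : Fin n → Fin n → Fin n → Fin n → Set
  ShadowEdge i u j v = (i ≡ j × T (A u v)) ⊎ (T (A i j) × T (dist u v))

  shadow-edge⇔ : ∀ i u j v → T (shadow A x (combine i u) (combine j v)) ⇔ ShadowEdge i u j v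
  shadow-edge⇔ i u j v =
    subst (λ b → T b ⇔ ShadowEdge i u j v) (sym (shadow-combine i u j v)) adjacency⇔
    where
    adjacency⇔ : T (shadow-adjacency (i , u) (j , v)) ⇔ ShadowEdge i u j v
    adjacency⇔ with i ≟ j
    ... | yes refl = mk⇔ (λ uv → inj₁ (refl , subst T (∨-identityʳ (A u v)) uv))
                         [ (λ (_ , uv) → subst T (sym (∨-identityʳ (A u v))) uv)
                         , (λ (ii , _) → ⊥-elim (edge⇒≢ ii refl)) ]
    ... | no i≢j  = mk⇔ (inj₂ ∘ to T-∧) [ (λ (i≡j , _) → ⊥-elim (i≢j i≡j)) , from T-∧ ]

module ShadowOfEdgeRegular {n d l} (A : Adj n) (simple : IsSimple A) (er : IsER A d l) (x : ℕ) where
  open Shadow A (proj₂ simple) x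

  DegreeCondition : ℕ → Set
  DegreeCondition dbar = ∀ v → d * (1 + count (dist v)) ≡ dbar

  SameCopyCondition : ℕ → Set
  SameCopyCondition lbar = ∀ u v → T (A u v) → l + d * count (λ w → dist u w ∧ dist v w) ≡ lbar

  AdjacentCopiesCondition : ℕ → Set
  AdjacentCopiesCondition lbar = ∀ v w → T (dist v w) →
    count (λ z → dist v z ∧ A w z) + count (λ z → A v z ∧ dist w z)
    + l * count (λ z → dist v z ∧ dist w z) ≡ lbar

  ShadowConditions : Set
  ShadowConditions =
    ∃₂ λ dbar lbar → DegreeCondition dbar × SameCopyCondition lbar × AdjacentCopiesCondition lbar

  deg-shadow-regular : ∀ i u → deg (shadow A x) (combine i u) ≡ d * (1 + count (dist u))
  deg-shadow-regular i u = begin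
    deg (shadow A x) (combine i u)      ≡⟨ deg-shadow i u ⟩
    deg A u + deg A i * count (dist u)  ≡⟨ cong₂ (λ a b → a + b * count (dist u)) (proj₁ er u) (proj₁ er i) ⟩
    d + d * count (dist u)              ≡⟨ *-suc d (count (dist u)) ⟨
    d * (1 + count (dist u))            ∎
    where open ≡-Reasoning

  common-shadow-sameCopy : ∀ i u v → T (A u v) →
    common (shadow A x) (combine i u) (combine i v) ≡ l + d * count (λ w → dist u w ∧ dist v w)
  common-shadow-sameCopy i u v uv
    rewrite common-shadow i u i v | δ-diag i | proj₂ simple i | common-self A i | proj₁ er i | proj₂ er u v uv
    = cong (_+ d * count (λ w → dist u w ∧ dist v w))
           (trans (+-identityʳ (l + 0 + 0)) (trans (+-identityʳ (l + 0)) (+-identityʳ l)))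

  common-shadow-adjacentCopies : ∀ i j u v → T (A i j) →
    common (shadow A x) (combine i u) (combine j v)
    ≡ count (λ w → dist u w ∧ A v w) + count (λ w → A u w ∧ dist v w)
      + l * count (λ w → dist u w ∧ dist v w)
  common-shadow-adjacentCopies i j u v ij
    rewrite common-shadow i u j v | δ-off (edge⇒≢ ij) | to T-≡ ij | proj₁ simple j i | to T-≡ ij
          | proj₂ er i j ij
    = cong₂ (λ a b → a + b + l * count (λ w → dist u w ∧ dist v w))
            (+-identityʳ (count (λ w → dist u w ∧ A v w))) (+-identityʳ (count (λ w → A u w ∧ dist v w)))

  shadow-edgeRegular⇒conditions : x ≥ 1 → EdgeRegular (shadow A x) → ShadowConditions
  shadow-edgeRegular⇒conditions x≥1 (dbar , lbar , deg≡dbar , common≡lbar) =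
    dbar , lbar , degree-condition , sameCopy-condition , adjacentCopies-condition
    where
    degree-condition : DegreeCondition dbar
    degree-condition v = trans (sym (deg-shadow-regular v v)) (deg≡dbar (combine v v))
    sameCopy-condition : SameCopyCondition lbar
    sameCopy-condition u v uv = trans (sym (common-shadow-sameCopy u u v uv))
                                      (common≡lbar _ _ (from (shadow-edge⇔ u u u v) (inj₁ (refl , uv))))
    adjacentCopies-condition : AdjacentCopiesCondition lbar
    adjacentCopies-condition v w vw with distExactly⇒edge A x≥1 v w vw
    ... | i , j , ij = trans (sym (common-shadow-adjacentCopies i j v w ij))
                             (common≡lbar _ _ (from (shadow-edge⇔ i v j w) (inj₂ (ij , vw))))

  conditions⇒shadow-edgeRegular : ShadowConditions → EdgeRegular (shadow A x)
  conditions⇒shadow-edgeRegular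
    (dbar , lbar , degree-condition , sameCopy-condition , adjacentCopies-condition) =
    dbar , lbar , deg≡dbar , common≡lbar
    where
    deg≡dbar : ∀ p → deg (shadow A x) p ≡ dbar
    deg≡dbar p with combine-surjective {n} p
    ... | i , u , refl = trans (deg-shadow-regular i u) (degree-condition u)
    common≡lbar : ∀ p q → T (shadow A x p q) → common (shadow A x) p q ≡ lbar
    common≡lbar p q pq with combine-surjective {n} p | combine-surjective {n} q
    ... | i , u , refl | j , v , refl with to (shadow-edge⇔ i u j v) pq
    ... | inj₁ (refl , uv) = trans (common-shadow-sameCopy i u v uv) (sameCopy-condition u v uv)
    ... | inj₂ (ij , uv)   =
      trans (common-shadow-adjacentCopies i j u v ij) (adjacentCopies-condition u v uv)

theorem4p2 : (n d l x : ℕ) (A : Adj n) → IsSimple A → IsER A d l → x ≥ 1 →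
    EdgeRegular (shadow A x) ⇔
      ∃₂ λ (dbar lbar : ℕ) →
        (∀ v → d * (1 + count (distExactly A x v)) ≡ dbar)
        × (∀ u v → T (A u v) →
             l + d * count (λ w → distExactly A x u w ∧ distExactly A x v w) ≡ lbar)
        × (∀ v w → T (distExactly A x v w) →
             count (λ z → distExactly A x v z ∧ A w z)
             + count (λ z → A v z ∧ distExactly A x w z)
             + l * count (λ z → distExactly A x v z ∧ distExactly A x w z) ≡ lbar)
theorem4p2 n d l x A simple er x≥1 =
  mk⇔ (shadow-edgeRegular⇒conditions x≥1) conditions⇒shadow-edgeRegular
  where open ShadowOfEdgeRegular A simple er x
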